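{- Let $\boldsymbol v\in\{0,1\}^\omega$. Then (i) $\varphi(\boldsymbol v)\in U$ if and only if $\boldsymbol v\in U$; and (ii) $1\varphi(\boldsymbol v)\in U$ if and only if $0\boldsymbol v\in U$ or $\boldsymbol v\in U_{00}$.
   Context: $\varphi$ is the morphism $0\mapsto 01$, $1\mapsto 0$. For non-empty $X$, $X^-$ is $X$ with its last letter erased; a $4^-$-power is $XXXX^-$ with $X$ non-empty; a binary word is faux-bonacci if it has no factor $11$ and no factor that is a $4^-$-power. $U$ is the set of faux-bonacci $\omega$-words over $\{0,1\}$, and for a finite word $u$, $U_u=U\cap u\{0,1\}^\omega$ is the set of those beginning with $u$. -}

module Defs where

open import Data.Nat using (ℕ; zero; suc; _+_)
open import Data.List using (List; []; _∷_; _++_; length)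
open import Data.Product using (Σ; _×_; ∃; ∃-syntax)
open import Relation.Binary.PropositionalEquality using (_≡_; _≢_)
open import Relation.Nullary using (¬_)

data Bit : Set where
  𝟎 𝟏 : Bit

Word : Set
Word = ℕ → Bit

_◂_ : Bit → Word → Word
(a ◂ w) zero    = a
(a ◂ w) (suc n) = w n

tail : Word → Word
tail w n = w (suc n)

-- φ on ω-words: φ(v) = φ(v₀) φ(v₁) φ(v₂) …  with φ(0)=01, φ(1)=0.
-- φω v n is the n-th letter of φ(v).
φω : Word → Word
φω v zero = 𝟎
φω v (suc n) with v zero
... | 𝟏 = φω (tail v) n
... | 𝟎 with n
...   | zero  = 𝟏
...   | suc m = φω (tail v) m

_⁻ : List Bit → List Bit
[] ⁻           = []
(x ∷ []) ⁻     = []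
(x ∷ y ∷ xs) ⁻ = x ∷ ((y ∷ xs) ⁻)

factor : Word → ℕ → ℕ → List Bit
factor w i zero    = []
factor w i (suc n) = w i ∷ factor w (suc i) n

HasFactor : Word → List Bit → Set
HasFactor w u = ∃[ i ] factor w i (length u) ≡ u

Is4⁻Power : List Bit → Set
Is4⁻Power u = ∃[ X ] (X ≢ []) × (u ≡ X ++ X ++ X ++ X ⁻)

FauxBonacci : Word → Set
FauxBonacci w = ¬ HasFactor w (𝟏 ∷ 𝟏 ∷ [])
              × (∀ u → HasFactor w u → ¬ Is4⁻Power u)

_∈U : Word → Set
w ∈U = FauxBonacci w

BeginsWith : Word → List Bit → Set
BeginsWith w u = factor w 0 (length u) ≡ u

_∈U[_] : Word → List Bit → Set
w ∈U[ u ] = w ∈U × BeginsWith w u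

{-# OPTIONS --safe #-}
-- A factor XXXX⁻ with |X| = p is the same as a factor of length 4p − 1 with period p.
-- The image of v k in φ(v) starts at position φpos v k; these positions are exactly the
-- 0s of φ(v), and the letter after such a 0 is the complement of v k. So φ(v) never
-- contains 11, and 11 in v becomes 000 in φ(v). A power XXXX⁻ in v maps to a factor of
-- φ(v) with period |φ(X)|, long enough because images have length at most 2 and the next
-- image starts with 0 again. Conversely a power in φ(v), moved to start at a 0, comes
-- from a power in v: equal second letters of images force equal letters of v, and the
-- absence of 11 in v keeps the preimage long enough.
-- For (ii), 1φ(v) is φ(0v) without its first letter, so beyond (i) only powers at the
-- very beginning of 0v or of 1φ(v) have to be examined.
module Submission where

open import Defs
open import Data.List using ([]; _∷_)
open import Data.Product using (_×_)
open import Data.Sum using (_⊎_)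
open import Function.Bundles using (_⇔_)

open import Data.Nat using (ℕ; zero; suc; _+_; _*_; _≤_; _<_; z≤n; s≤s)
open import Data.Nat.Properties
open import Data.Nat.Tactic.RingSolver using (solve-∀)
open import Data.List using (List; _++_; length)
open import Data.List.Properties using (length-++; ∷-injectiveˡ; ∷-injectiveʳ)
open import Data.Product using (∃-syntax; _,_; proj₁; proj₂)
open import Data.Sum using (inj₁; inj₂)
open import Data.Empty using (⊥; ⊥-elim)
open import Function.Base using (_∘_)
open import Function.Bundles using (mk⇔; Equivalence)
open import Relation.Nullary using (¬_)
open import Relation.Binary.PropositionalEquality

compl : Bit → Bit
compl 𝟎 = 𝟏
compl 𝟏 = 𝟎

compl-injective : ∀ {a b} → compl a ≡ compl b → a ≡ b
compl-injective {𝟎} {𝟎} _ = refl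
compl-injective {𝟏} {𝟏} _ = refl

𝟎≢𝟏 : 𝟎 ≢ 𝟏
𝟎≢𝟏 ()

≢𝟏⇒≡𝟎 : ∀ {b} → b ≢ 𝟏 → b ≡ 𝟎
≢𝟏⇒≡𝟎 {𝟎} _  = refl
≢𝟏⇒≡𝟎 {𝟏} b≢𝟏 = ⊥-elim (b≢𝟏 refl)

m+[n+o]≡n+[m+o] : ∀ m n o → m + (n + o) ≡ n + (m + o)
m+[n+o]≡n+[m+o] = solve-∀

3*n≡n+[n+n] : ∀ n → 3 * n ≡ n + (n + n)
3*n≡n+[n+n] = solve-∀

3*[1+n] : ∀ n → 3 * suc n ≡ suc (suc n + (suc n + n))
3*[1+n] = solve-∀

3*[2+n] : ∀ n → 3 * suc (suc n) ≡ 2 + (suc (suc n) + (suc (suc n) + n))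
3*[2+n] = solve-∀

-- The factor of length 4p − 1 at position i is XXXX⁻ with |X| = p.
record Is4⁻PowerAt (w : Word) (i p : ℕ) : Set where
  field periodic : ∀ j → 2 + j ≤ 3 * p → w (i + j) ≡ w (i + (p + j))
open Is4⁻PowerAt public

No11 : Word → Set
No11 w = ∀ i → ¬ (w i ≡ 𝟏 × w (suc i) ≡ 𝟏)

No4⁻Power : Word → Set
No4⁻Power w = ∀ i p → ¬ Is4⁻PowerAt w i (suc p)

FauxBonacci′ : Word → Set
FauxBonacci′ w = No11 w × No4⁻Power w

no4⁻Power : ∀ {w} → No4⁻Power w → ∀ {i p} → 0 < p → ¬ Is4⁻PowerAt w i p
no4⁻Power nr {p = suc p} _ = nr _ p

Is4⁻PowerAt-transport : ∀ {w w′ c c′ p} → (∀ n → w (c + n) ≡ w′ (c′ + n)) →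
                        Is4⁻PowerAt w c p → Is4⁻PowerAt w′ c′ p
Is4⁻PowerAt-transport {p = p} w≗w′ R .periodic j b = trans (sym (w≗w′ j)) (trans (R .periodic j b) (w≗w′ (p + j)))

constant⇒Is4⁻PowerAt₁ : ∀ {w i b} → w i ≡ b → w (suc i) ≡ b → w (2 + i) ≡ b → Is4⁻PowerAt w i 1
constant⇒Is4⁻PowerAt₁ {w} {i} e₀ e₁ e₂ .periodic zero _ =
  trans (cong w (+-identityʳ i)) (trans e₀ (sym (trans (cong w (+-comm i 1)) e₁)))
constant⇒Is4⁻PowerAt₁ {w} {i} e₀ e₁ e₂ .periodic (suc zero) _ =
  trans (cong w (+-comm i 1)) (trans e₁ (sym (trans (cong w (+-comm i 2)) e₂)))
constant⇒Is4⁻PowerAt₁ e₀ e₁ e₂ .periodic (suc (suc j)) (s≤s (s≤s (s≤s ())))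

FauxBonacci′-tail : ∀ {w w′} → FauxBonacci′ w → (∀ n → w (suc n) ≡ w′ n) → FauxBonacci′ w′
FauxBonacci′-tail (no11 , nr) w≗w′ =
  (λ i (e , e′) → no11 (suc i) (trans (w≗w′ i) e , trans (w≗w′ (suc i)) e′)) ,
  (λ i p R → nr (suc i) p (Is4⁻PowerAt-transport (λ n → sym (w≗w′ (i + n))) R))

-- 𝟎 past the end of the list
at : List Bit → ℕ → Bit
at []       _       = 𝟎
at (x ∷ xs) zero    = x
at (x ∷ xs) (suc j) = at xs j

at-++ˡ : ∀ (xs ys : List Bit) {j} → j < length xs → at (xs ++ ys) j ≡ at xs j
at-++ˡ (x ∷ xs) ys {zero}  _        = refl
at-++ˡ (x ∷ xs) ys {suc j} (s≤s lt) = at-++ˡ xs ys lt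

at-++ʳ : ∀ (xs ys : List Bit) j → at (xs ++ ys) (length xs + j) ≡ at ys j
at-++ʳ []       ys j = refl
at-++ʳ (x ∷ xs) ys j = at-++ʳ xs ys j

at-++-cong : ∀ (xs ys zs : List Bit) {n} → (∀ j → j < n → at ys j ≡ at zs j) →
             ∀ j → j < length xs + n → at (xs ++ ys) j ≡ at (xs ++ zs) j
at-++-cong []       ys zs h j       lt       = h j lt
at-++-cong (x ∷ xs) ys zs h zero    _        = refl
at-++-cong (x ∷ xs) ys zs h (suc j) (s≤s lt) = at-++-cong xs ys zs h j lt

at-⁻ : ∀ (xs : List Bit) {j} → suc j < length xs → at (xs ⁻) j ≡ at xs j
at-⁻ (x ∷ [])     (s≤s ())
at-⁻ (x ∷ y ∷ xs) {zero}  _        = refl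
at-⁻ (x ∷ y ∷ xs) {suc j} (s≤s lt) = at-⁻ (y ∷ xs) lt

length-⁻ : ∀ x (xs : List Bit) → length ((x ∷ xs) ⁻) ≡ length xs
length-⁻ x []       = refl
length-⁻ x (y ∷ xs) = cong suc (length-⁻ y xs)

length-factor : ∀ w i n → length (factor w i n) ≡ n
length-factor w i zero    = refl
length-factor w i (suc n) = cong suc (length-factor w (suc i) n)

at-factor : ∀ w i {n j} → j < n → at (factor w i n) j ≡ w (i + j)
at-factor w i {suc n} {zero}  _        = cong w (sym (+-identityʳ i))
at-factor w i {suc n} {suc j} (s≤s lt) = trans (at-factor w (suc i) lt) (cong w (sym (+-suc i j)))

factor-++ : ∀ w i a b → factor w i (a + b) ≡ factor w i a ++ factor w (i + a) b
factor-++ w i zero    b = cong (λ k → factor w k b) (sym (+-identityʳ i))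
factor-++ w i (suc a) b =
  cong (w i ∷_) (trans (factor-++ w (suc i) a b) (cong (λ k → factor w (suc i) a ++ factor w k b) (sym (+-suc i a))))

factor-cong : ∀ w {i i′} n → (∀ j → j < n → w (i + j) ≡ w (i′ + j)) → factor w i n ≡ factor w i′ n
factor-cong w         zero    h = refl
factor-cong w {i} {i′} (suc n) h = cong₂ _∷_
  (trans (cong w (sym (+-identityʳ i))) (trans (h 0 (s≤s z≤n)) (cong w (+-identityʳ i′))))
  (factor-cong w n λ j lt →
     trans (cong w (sym (+-suc i j))) (trans (h (suc j) (s≤s lt)) (cong w (+-suc i′ j))))

factor-⁻ : ∀ w i n → factor w i (suc n) ⁻ ≡ factor w i n
factor-⁻ w i zero    = refl
factor-⁻ w i (suc n) = cong (w i ∷_) (factor-⁻ w (suc i) n)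

factor-periodic : ∀ w i p n → (∀ j → j < n → w (i + j) ≡ w (i + (p + j))) →
                  factor w i (p + n) ≡ factor w i p ++ factor w i n
factor-periodic w i p n per = trans (factor-++ w i p n) (cong (factor w i p ++_)
  (factor-cong w n λ j lt → trans (cong w (+-assoc i p j)) (sym (per j lt))))

4⁻Power-periodic : ∀ x xs → let X = x ∷ xs ; u = X ++ X ++ X ++ X ⁻ in
                   ∀ j → j < length X + (length X + length xs) → at u j ≡ at u (length X + j)
4⁻Power-periodic x xs j lt =
  trans (at-++-cong X (X ++ X ++ X ⁻) (X ++ X ⁻) (at-++-cong X (X ++ X ⁻) (X ⁻) X++X⁻≈X⁻) j lt)
        (sym (at-++ʳ X (X ++ X ++ X ⁻) j))
  where
  X = x ∷ xs
  X++X⁻≈X⁻ : ∀ j → j < length xs → at (X ++ X ⁻) j ≡ at (X ⁻) j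
  X++X⁻≈X⁻ j lt = trans (at-++ˡ X (X ⁻) (m<n⇒m<1+n lt)) (sym (at-⁻ X (s≤s lt)))

4⁻Power⇒Is4⁻PowerAt : ∀ {w u} → HasFactor w u → Is4⁻Power u → ∃[ i ] ∃[ m ] Is4⁻PowerAt w i (suc m)
4⁻Power⇒Is4⁻PowerAt {w} (i , hf) ([] , X≢[] , _) = ⊥-elim (X≢[] refl)
4⁻Power⇒Is4⁻PowerAt {w} (i , hf) (x ∷ xs , _ , refl) = i , length xs , R
  where
  X = x ∷ xs
  p = length X
  u = X ++ X ++ X ++ X ⁻
  length-u : length u ≡ p + (p + (p + length xs))
  length-u = begin
    length u                            ≡⟨ length-++ X ⟩
    p + length (X ++ X ++ X ⁻)          ≡⟨ cong (p +_) (length-++ X) ⟩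
    p + (p + length (X ++ X ⁻))         ≡⟨ cong (λ n → p + (p + n)) (length-++ X) ⟩
    p + (p + (p + length (X ⁻)))        ≡⟨ cong (λ n → p + (p + (p + n))) (length-⁻ x xs) ⟩
    p + (p + (p + length xs))           ∎
    where open ≡-Reasoning
  at-u : ∀ {j} → j < length u → at u j ≡ w (i + j)
  at-u {j} lt = trans (cong (λ v → at v j) (sym hf)) (at-factor w i lt)
  R : Is4⁻PowerAt w i p
  R .periodic j b = trans (sym (at-u j<∣u∣)) (trans (4⁻Power-periodic x xs j j<) (at-u p+j<∣u∣))
    where
    j< : j < p + (p + length xs)
    j< = ≤-pred (subst (2 + j ≤_) (3*[1+n] (length xs)) b)
    j<∣u∣ : j < length u
    j<∣u∣ = subst (j <_) (sym length-u) (<-≤-trans j< (+-monoʳ-≤ p (+-monoʳ-≤ p (m≤n+m _ p))))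
    p+j<∣u∣ : p + j < length u
    p+j<∣u∣ = subst (p + j <_) (sym length-u) (+-monoʳ-< p j<)

Is4⁻PowerAt⇒4⁻Power : ∀ {w i m} → Is4⁻PowerAt w i (suc m) →
                      let u = factor w i (suc m + (suc m + (suc m + m))) in HasFactor w u × Is4⁻Power u
Is4⁻PowerAt⇒4⁻Power {w} {i} {m} R =
  (i , cong (factor w i) (length-factor w i _)) , (factor w i p , (λ ()) , decomposition)
  where
  p = suc m
  per : ∀ {n} → n ≤ p + (p + m) → ∀ j → j < n → w (i + j) ≡ w (i + (p + j))
  per n≤ j lt = R .periodic j (subst (2 + j ≤_) (sym (3*[1+n] m)) (s≤s (<-≤-trans lt n≤)))
  decomposition : factor w i (p + (p + (p + m))) ≡ factor w i p ++ factor w i p ++ factor w i p ++ factor w i p ⁻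
  decomposition = begin
    factor w i (p + (p + (p + m)))                           ≡⟨ factor-periodic w i p _ (per ≤-refl) ⟩
    X ++ factor w i (p + (p + m))                            ≡⟨ cong (X ++_) (factor-periodic w i p _ (per (m≤n+m _ p))) ⟩
    X ++ X ++ factor w i (p + m)                             ≡⟨ cong (λ v → X ++ X ++ v) (factor-periodic w i p _ (per m≤3p)) ⟩
    X ++ X ++ X ++ factor w i m                              ≡⟨ cong (λ v → X ++ X ++ X ++ v) (sym (factor-⁻ w i m)) ⟩
    X ++ X ++ X ++ X ⁻                                       ∎
    where
    open ≡-Reasoning
    X = factor w i p
    m≤3p : m ≤ p + (p + m)
    m≤3p = ≤-trans (m≤n+m m p) (m≤n+m (p + m) p)

FauxBonacci⇔FauxBonacci′ : ∀ w → FauxBonacci w ⇔ FauxBonacci′ w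
FauxBonacci⇔FauxBonacci′ w = mk⇔
  (λ (no11 , no4⁻) →
     (λ i (e , e′) → no11 (i , cong₂ (λ a b → a ∷ b ∷ []) e e′)) ,
     (λ i m R → let (f , pw) = Is4⁻PowerAt⇒4⁻Power R in no4⁻ _ f pw))
  (λ (no11 , no4⁻) →
     (λ (i , e) → no11 i (∷-injectiveˡ e , ∷-injectiveˡ (∷-injectiveʳ e))) ,
     (λ u f pw → let (i , m , R) = 4⁻Power⇒Is4⁻PowerAt f pw in no4⁻ i m R))

∣φ∣ : Bit → ℕ
∣φ∣ 𝟎 = 2
∣φ∣ 𝟏 = 1

-- φpos v k = |φ(v₀ ⋯ v_{k−1})|, the position in φω v where the image of v k starts.
φpos : Word → ℕ → ℕ
φpos v zero    = 0
φpos v (suc k) = ∣φ∣ (v zero) + φpos (tail v) k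

drop : ℕ → Word → Word
drop zero    v = v
drop (suc k) v = drop k (tail v)

drop-apply : ∀ k v n → drop k v n ≡ v (k + n)
drop-apply zero    v n = refl
drop-apply (suc k) v n = drop-apply k (tail v) n

φω-∣φ∣ : ∀ v n → φω v (∣φ∣ (v zero) + n) ≡ φω (tail v) n
φω-∣φ∣ v n with v zero in e
... | 𝟎 rewrite e = refl
... | 𝟏 rewrite e = refl

φω-1 : ∀ v → φω v 1 ≡ compl (v zero)
φω-1 v with v zero
... | 𝟎 = refl
... | 𝟏 = refl

φω-drop : ∀ k v n → φω v (φpos v k + n) ≡ φω (drop k v) n
φω-drop zero    v n = refl
φω-drop (suc k) v n = begin
  φω v ((∣φ∣ (v zero) + φpos (tail v) k) + n) ≡⟨ cong (φω v) (+-assoc (∣φ∣ (v zero)) _ n) ⟩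
  φω v (∣φ∣ (v zero) + (φpos (tail v) k + n)) ≡⟨ φω-∣φ∣ v _ ⟩
  φω (tail v) (φpos (tail v) k + n)           ≡⟨ φω-drop k (tail v) n ⟩
  φω (drop k (tail v)) n                      ∎
  where open ≡-Reasoning

φω-φpos : ∀ v k → φω v (φpos v k) ≡ 𝟎
φω-φpos v k = trans (cong (φω v) (sym (+-identityʳ (φpos v k)))) (φω-drop k v 0)

φω-suc-φpos : ∀ v k → φω v (suc (φpos v k)) ≡ compl (v k)
φω-suc-φpos v k = begin
  φω v (suc (φpos v k))   ≡⟨ cong (φω v) (+-comm 1 (φpos v k)) ⟩
  φω v (φpos v k + 1)     ≡⟨ φω-drop k v 1 ⟩
  φω (drop k v) 1         ≡⟨ φω-1 (drop k v) ⟩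
  compl (drop k v 0)      ≡⟨ cong compl (trans (drop-apply k v 0) (cong v (+-identityʳ k))) ⟩
  compl (v k)             ∎
  where open ≡-Reasoning

φpos-+ : ∀ v k n → φpos v (k + n) ≡ φpos v k + φpos (drop k v) n
φpos-+ v zero    n = refl
φpos-+ v (suc k) n =
  trans (cong (∣φ∣ (v zero) +_) (φpos-+ (tail v) k n)) (sym (+-assoc (∣φ∣ (v zero)) _ _))

φpos-suc : ∀ v k → φpos v (suc k) ≡ ∣φ∣ (v k) + φpos v k
φpos-suc v k = begin
  φpos v (suc k)                             ≡⟨ cong (φpos v) (+-comm 1 k) ⟩
  φpos v (k + 1)                             ≡⟨ φpos-+ v k 1 ⟩
  φpos v k + (∣φ∣ (drop k v zero) + 0)       ≡⟨ cong (λ n → φpos v k + (∣φ∣ n + 0)) (drop-apply k v 0) ⟩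
  φpos v k + (∣φ∣ (v (k + 0)) + 0)           ≡⟨ cong (λ n → φpos v k + (∣φ∣ (v n) + 0)) (+-identityʳ k) ⟩
  φpos v k + (∣φ∣ (v k) + 0)                 ≡⟨ cong (φpos v k +_) (+-identityʳ _) ⟩
  φpos v k + ∣φ∣ (v k)                       ≡⟨ +-comm (φpos v k) _ ⟩
  ∣φ∣ (v k) + φpos v k                       ∎
  where open ≡-Reasoning

φpos-suc-≡ : ∀ v k {b} → v k ≡ b → φpos v (suc k) ≡ ∣φ∣ b + φpos v k
φpos-suc-≡ v k e = trans (φpos-suc v k) (cong (λ b → ∣φ∣ b + φpos v k) e)

φpos-prefix : ∀ {a b} k → (∀ n → n < k → a n ≡ b n) → φpos a k ≡ φpos b k
φpos-prefix zero    h = refl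
φpos-prefix (suc k) h = cong₂ _+_ (cong ∣φ∣ (h 0 (s≤s z≤n))) (φpos-prefix k λ n lt → h (suc n) (s≤s lt))

φpos-mono : ∀ a {j k} → j ≤ k → φpos a j ≤ φpos a k
φpos-mono a {zero}          _        = z≤n
φpos-mono a {suc j} {suc k} (s≤s le) = +-monoʳ-≤ (∣φ∣ (a zero)) (φpos-mono (tail a) le)

1≤∣φ∣ : ∀ b → 1 ≤ ∣φ∣ b
1≤∣φ∣ 𝟎 = s≤s z≤n
1≤∣φ∣ 𝟏 = s≤s z≤n

∣φ∣≤2 : ∀ b → ∣φ∣ b ≤ 2
∣φ∣≤2 𝟎 = ≤-refl
∣φ∣≤2 𝟏 = s≤s z≤n

φpos-< : ∀ a k → φpos a k < φpos a (suc k)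
φpos-< a k = subst (φpos a k <_) (sym (φpos-suc a k)) (+-monoˡ-≤ (φpos a k) (1≤∣φ∣ (a k)))

φpos-suc-≤ : ∀ a k → φpos a (suc k) ≤ 2 + φpos a k
φpos-suc-≤ a k = subst (_≤ 2 + φpos a k) (sym (φpos-suc a k)) (+-monoˡ-≤ (φpos a k) (∣φ∣≤2 (a k)))

φω-position : ∀ v n → ∃[ k ] (n ≡ φpos v k ⊎ (n ≡ suc (φpos v k) × v k ≡ 𝟎))
φω-position v zero = 0 , inj₁ refl
φω-position v (suc n) with φω-position v n
... | k , inj₂ (n≡ , vk) = suc k , inj₁ (trans (cong suc n≡) (sym (φpos-suc-≡ v k vk)))
... | k , inj₁ n≡ with v k in vk
...   | 𝟎 = k , inj₂ (cong suc n≡ , vk)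
...   | 𝟏 = suc k , inj₁ (trans (cong suc n≡) (sym (φpos-suc-≡ v k vk)))

φω-𝟎⇒φpos : ∀ {v n} → φω v n ≡ 𝟎 → ∃[ k ] n ≡ φpos v k
φω-𝟎⇒φpos {v} {n} e with φω-position v n
... | k , inj₁ n≡          = k , n≡
... | k , inj₂ (n≡ , vk≡𝟎) = ⊥-elim (𝟎≢𝟏 (begin
  𝟎                       ≡⟨ sym e ⟩
  φω v n                  ≡⟨ cong (φω v) n≡ ⟩
  φω v (suc (φpos v k))   ≡⟨ φω-suc-φpos v k ⟩
  compl (v k)             ≡⟨ cong compl vk≡𝟎 ⟩
  𝟏                       ∎))
  where open ≡-Reasoning

φω-𝟏⇒φpos : ∀ {v n} → φω v (suc n) ≡ 𝟏 → ∃[ k ] n ≡ φpos v k × v k ≡ 𝟎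
φω-𝟏⇒φpos {v} {n} e with φω-position v (suc n)
... | k , inj₁ n≡          = ⊥-elim (𝟎≢𝟏 (trans (sym (φω-φpos v k)) (trans (cong (φω v) (sym n≡)) e)))
... | k , inj₂ (n≡ , vk≡𝟎) = k , suc-injective n≡ , vk≡𝟎

φω-no11 : ∀ v → No11 (φω v)
φω-no11 v i (e , e′) with φω-position v i
... | k , inj₁ i≡          = 𝟎≢𝟏 (trans (sym (φω-φpos v k)) (trans (cong (φω v) (sym i≡)) e))
... | k , inj₂ (i≡ , vk≡𝟎) = 𝟎≢𝟏 (trans (sym (φω-φpos v (suc k))) (trans (cong (φω v) suc-i≡) e′))
  where
  suc-i≡ : φpos v (suc k) ≡ suc i
  suc-i≡ = trans (φpos-suc-≡ v k vk≡𝟎) (cong suc (sym i≡))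

φω-prefix : ∀ {a b} m → (∀ n → n < m → a n ≡ b n) → ∀ J → J ≤ φpos a m → φω a J ≡ φω b J
φω-prefix m h zero _ = refl
φω-prefix {a} {b} (suc m) h (suc J) le with a zero | b zero | h 0 (s≤s z≤n)
... | 𝟏 | .𝟏 | refl = φω-prefix m (λ n lt → h (suc n) (s≤s lt)) J (≤-pred le)
... | 𝟎 | .𝟎 | refl with J
...   | zero   = refl
...   | suc J′ = φω-prefix m (λ n lt → h (suc n) (s≤s lt)) J′ (≤-pred (≤-pred le))

HasPeriodUpTo : Word → ℕ → ℕ → Set
HasPeriodUpTo a q m = ∀ n → n < m → a n ≡ a (q + n)

HasPeriodUpTo-extend : ∀ {a q m} → HasPeriodUpTo a q m → a m ≡ a (q + m) → HasPeriodUpTo a q (suc m)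
HasPeriodUpTo-extend per e n lt with m≤n⇒m<n∨m≡n (≤-pred lt)
... | inj₁ n<m  = per n n<m
... | inj₂ refl = e

HasPeriodUpTo-≤ : ∀ {a q m m′} → m′ ≤ m → HasPeriodUpTo a q m → HasPeriodUpTo a q m′
HasPeriodUpTo-≤ m′≤m per n lt = per n (<-≤-trans lt m′≤m)

Is4⁻PowerAt⇒HasPeriodUpTo : ∀ {a s} → Is4⁻PowerAt a 0 (suc s) → HasPeriodUpTo a (suc s) (suc s + (suc s + s))
Is4⁻PowerAt⇒HasPeriodUpTo {s = s} R n lt = R .periodic n (subst (2 + n ≤_) (sym (3*[1+n] s)) (s≤s lt))

φpos-periodic : ∀ {a q n} → HasPeriodUpTo a q n → φpos a (q + n) ≡ φpos a q + φpos a n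
φpos-periodic {a} {q} {n} per = trans (φpos-+ a q n)
  (cong (φpos a q +_) (φpos-prefix n λ m lt → trans (drop-apply q a m) (sym (per m lt))))

φpos-periodic³ : ∀ {a q n} → HasPeriodUpTo a q (q + (q + n)) →
                 φpos a (q + (q + n)) ≡ φpos a q + (φpos a q + φpos a n)
φpos-periodic³ {a} {q} {n} per = trans (φpos-periodic (HasPeriodUpTo-≤ (m≤n+m _ q) per))
  (cong (φpos a q +_) (φpos-periodic (HasPeriodUpTo-≤ (≤-trans (m≤n+m n q) (m≤n+m (q + n) q)) per)))

φω-periodic : ∀ {a q m} → HasPeriodUpTo a q m → ∀ J → J ≤ φpos a m → φω a J ≡ φω a (φpos a q + J)
φω-periodic {a} {q} {m} per J le =
  trans (φω-prefix m (λ n lt → trans (per n lt) (sym (drop-apply q a n))) J le) (sym (φω-drop q a J))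

φω-Is4⁻PowerAt : ∀ {a q m o} → HasPeriodUpTo a q m → (∀ J → 2 + J ≤ 3 * φpos a q → o + J ≤ φpos a m) →
                 Is4⁻PowerAt (φω a) o (φpos a q)
φω-Is4⁻PowerAt {a} {q} {o = o} per bound .periodic J b =
  trans (φω-periodic per (o + J) (bound J b)) (cong (φω a) (m+[n+o]≡n+[m+o] (φpos a q) o J))

φω-Is4⁻PowerAt₀ : ∀ {a s} → Is4⁻PowerAt a 0 (suc s) → Is4⁻PowerAt (φω a) 0 (φpos a (suc s))
φω-Is4⁻PowerAt₀ {a} {s} R = φω-Is4⁻PowerAt per bound
  where
  q = suc s
  P = φpos a q
  per = Is4⁻PowerAt⇒HasPeriodUpTo R
  bound : ∀ J → 2 + J ≤ 3 * P → J ≤ φpos a (q + (q + s))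
  bound J b = +-cancelˡ-≤ 2 _ _ (begin
    2 + J                        ≤⟨ b ⟩
    3 * P                        ≡⟨ 3*n≡n+[n+n] P ⟩
    P + (P + P)                  ≤⟨ +-monoʳ-≤ P (+-monoʳ-≤ P (φpos-suc-≤ a s)) ⟩
    P + (P + (2 + φpos a s))     ≡⟨ cong (P +_) (m+[n+o]≡n+[m+o] P 2 _) ⟩
    P + (2 + (P + φpos a s))     ≡⟨ m+[n+o]≡n+[m+o] P 2 _ ⟩
    2 + (P + (P + φpos a s))     ≡⟨ cong (2 +_) (sym (φpos-periodic³ per)) ⟩
    2 + φpos a (q + (q + s))     ∎)
    where open ≤-Reasoning

3≤∣φ∣+∣φ∣ : ∀ {x y} → ¬ (x ≡ 𝟏 × y ≡ 𝟏) → 3 ≤ ∣φ∣ x + ∣φ∣ y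
3≤∣φ∣+∣φ∣ {𝟎} {𝟎} _ = s≤s (s≤s (s≤s z≤n))
3≤∣φ∣+∣φ∣ {𝟎} {𝟏} _ = ≤-refl
3≤∣φ∣+∣φ∣ {𝟏} {𝟎} _ = ≤-refl
3≤∣φ∣+∣φ∣ {𝟏} {𝟏} ¬11 = ⊥-elim (¬11 (refl , refl))

φpos-+2 : ∀ {a} → No11 a → ∀ r → φpos a r + 3 ≤ φpos a (2 + r)
φpos-+2 {a} no11 r = begin
  φpos a r + 3                                  ≤⟨ +-monoʳ-≤ (φpos a r) (3≤∣φ∣+∣φ∣ (no11 r)) ⟩
  φpos a r + (∣φ∣ (a r) + ∣φ∣ (a (suc r)))      ≡⟨ x+[y+z]≡z+[y+x] (φpos a r) (∣φ∣ (a r)) _ ⟩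
  ∣φ∣ (a (suc r)) + (∣φ∣ (a r) + φpos a r)      ≡⟨ cong (∣φ∣ (a (suc r)) +_) (sym (φpos-suc a r)) ⟩
  ∣φ∣ (a (suc r)) + φpos a (suc r)              ≡⟨ sym (φpos-suc a (suc r)) ⟩
  φpos a (2 + r)                                ∎
  where
  open ≤-Reasoning
  x+[y+z]≡z+[y+x] : ∀ x y z → x + (y + z) ≡ z + (y + x)
  x+[y+z]≡z+[y+x] = solve-∀

φω-period≡𝟎 : ∀ {a P} → 0 < P → Is4⁻PowerAt (φω a) 0 P → φω a P ≡ 𝟎
φω-period≡𝟎 {a} {P} 0<P R =
  trans (cong (φω a) (sym (+-identityʳ P))) (sym (R .periodic 0 (≤-trans (n≤1+n 2) (*-monoʳ-≤ 3 0<P))))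

φω-Is4⁻PowerAt-φpos₁ : ∀ {a} → No11 a → Is4⁻PowerAt (φω a) 0 (φpos a 1) → a 0 ≡ 𝟎
φω-Is4⁻PowerAt-φpos₁ {a} no11 R = ≢𝟏⇒≡𝟎 λ a₀ → no11 0 (a₀ , trans (compl-injective a₁≡a₀) a₀)
  where
  open ≡-Reasoning
  3≤3P : 3 ≤ 3 * φpos a 1
  3≤3P = *-monoʳ-≤ 3 (φpos-< a 0)
  a₁≡a₀ : compl (a 1) ≡ compl (a 0)
  a₁≡a₀ = begin
    compl (a 1)              ≡⟨ sym (φω-suc-φpos a 1) ⟩
    φω a (suc (φpos a 1))    ≡⟨ cong (φω a) (+-comm 1 (φpos a 1)) ⟩
    φω a (φpos a 1 + 1)      ≡⟨ sym (R .periodic 1 3≤3P) ⟩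
    φω a 1                   ≡⟨ φω-1 a ⟩
    compl (a 0)              ∎

-- Along a, while the power of φω a lasts, the images of a n and a (q + n) start P apart,
-- so their second letters, the complements of a n and a (q + n), coincide.
module Desubstitution {a} (no11 : No11 a) {q} (R : Is4⁻PowerAt (φω a) 0 (φpos a q)) where
  P = φpos a q

  letter-shift : ∀ {n} → φpos a n + 3 ≤ 3 * P → φpos a (q + n) ≡ P + φpos a n → a n ≡ a (q + n)
  letter-shift {n} b e = compl-injective (begin
    compl (a n)                   ≡⟨ sym (φω-suc-φpos a n) ⟩
    φω a (suc (φpos a n))         ≡⟨ R .periodic (suc (φpos a n)) (subst (_≤ 3 * P) (+-comm _ 3) b) ⟩
    φω a (P + suc (φpos a n))     ≡⟨ cong (φω a) (trans (+-suc P _) (cong suc (sym e))) ⟩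
    φω a (suc (φpos a (q + n)))   ≡⟨ φω-suc-φpos a (q + n) ⟩
    compl (a (q + n))             ∎)
    where open ≡-Reasoning

  φpos-shift : ∀ n → φpos a n + 2 ≤ 3 * P → φpos a (q + n) ≡ P + φpos a n
  φpos-shift zero    _ = trans (cong (φpos a) (+-identityʳ q)) (sym (+-identityʳ P))
  φpos-shift (suc n) b = begin
    φpos a (q + suc n)                 ≡⟨ cong (φpos a) (+-suc q n) ⟩
    φpos a (suc (q + n))               ≡⟨ φpos-suc a (q + n) ⟩
    ∣φ∣ (a (q + n)) + φpos a (q + n)   ≡⟨ cong₂ _+_ (cong ∣φ∣ (sym (letter-shift b′ IH))) IH ⟩
    ∣φ∣ (a n) + (P + φpos a n)         ≡⟨ m+[n+o]≡n+[m+o] (∣φ∣ (a n)) P (φpos a n) ⟩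
    P + (∣φ∣ (a n) + φpos a n)         ≡⟨ cong (P +_) (sym (φpos-suc a n)) ⟩
    P + φpos a (suc n)                 ∎
    where
    open ≡-Reasoning
    b′ : φpos a n + 3 ≤ 3 * P
    b′ = ≤-trans (≤-reflexive (+-suc _ 2)) (≤-trans (+-monoˡ-≤ 2 (φpos-< a n)) b)
    IH : φpos a (q + n) ≡ P + φpos a n
    IH = φpos-shift n (≤-trans (+-monoʳ-≤ _ (n≤1+n 2)) b′)

  shift : (∀ j → 2 + j ≤ 3 * q → φpos a j + 3 ≤ 3 * P) → Is4⁻PowerAt a 0 q
  shift bound .periodic j b = letter-shift (bound j b) (φpos-shift j (≤-trans (+-monoʳ-≤ _ (n≤1+n 2)) (bound j b)))

  bound₁ : q ≡ 1 → ∀ j → 2 + j ≤ 3 * q → φpos a j + 3 ≤ 3 * P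
  bound₁ refl j b = begin
    φpos a j + 3    ≤⟨ +-monoˡ-≤ 3 (φpos-mono a (≤-pred (≤-pred b))) ⟩
    φpos a 1 + 3    ≡⟨ cong (_+ 3) P≡2 ⟩
    5               ≤⟨ n≤1+n 5 ⟩
    6               ≡⟨ cong (3 *_) (sym P≡2) ⟩
    3 * φpos a 1    ∎
    where
    open ≤-Reasoning
    P≡2 : φpos a 1 ≡ 2
    P≡2 = cong (λ b → ∣φ∣ b + 0) (φω-Is4⁻PowerAt-φpos₁ no11 R)

  bound₂₊ : ∀ {r} → q ≡ 2 + r → ∀ j → 2 + j ≤ 3 * q → φpos a j + 3 ≤ 3 * P
  bound₂₊ {r} refl j b = begin
    φpos a j + 3                  ≤⟨ +-monoˡ-≤ 3 (φpos-mono a (+-cancelˡ-≤ 2 _ _ (subst (2 + j ≤_) (3*[2+n] r) b))) ⟩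
    φpos a (q + (q + r)) + 3      ≡⟨ cong (_+ 3) (trans e₂ (cong (P +_) e₁)) ⟩
    P + (P + φpos a r) + 3        ≡⟨ x+[x+y]+3≡x+[x+[y+3]] P (φpos a r) ⟩
    P + (P + (φpos a r + 3))      ≤⟨ +-monoʳ-≤ P (+-monoʳ-≤ P (φpos-+2 no11 r)) ⟩
    P + (P + P)                   ≡⟨ sym (3*n≡n+[n+n] P) ⟩
    3 * P                         ∎
    where
    open ≤-Reasoning
    x+[x+y]+3≡x+[x+[y+3]] : ∀ x y → x + (x + y) + 3 ≡ x + (x + (y + 3))
    x+[x+y]+3≡x+[x+[y+3]] = solve-∀
    r+3≤P : φpos a r + 3 ≤ P
    r+3≤P = φpos-+2 no11 r
    e₁ : φpos a (q + r) ≡ P + φpos a r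
    e₁ = φpos-shift r (≤-trans (+-monoʳ-≤ _ (n≤1+n 2)) (≤-trans r+3≤P (m≤m+n P _)))
    e₂ : φpos a (q + (q + r)) ≡ P + φpos a (q + r)
    e₂ = φpos-shift (q + r) (subst (λ n → n + 2 ≤ 3 * P) (sym e₁) (begin
      P + φpos a r + 2      ≡⟨ +-assoc P _ 2 ⟩
      P + (φpos a r + 2)    ≤⟨ +-monoʳ-≤ P (≤-trans (+-monoʳ-≤ _ (n≤1+n 2)) (≤-trans r+3≤P (m≤m+n P _))) ⟩
      P + (P + P)           ≡⟨ sym (3*n≡n+[n+n] P) ⟩
      3 * P                 ∎))

desubstitute : ∀ {a} → No11 a → ∀ {P} → 0 < P → Is4⁻PowerAt (φω a) 0 P → ∃[ q ] 0 < q × Is4⁻PowerAt a 0 q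
desubstitute {a} no11 {P} 0<P R with φω-𝟎⇒φpos {a} {P} (φω-period≡𝟎 0<P R)
... | zero          , refl = ⊥-elim (<-irrefl refl 0<P)
... | suc zero      , refl = 1 , s≤s z≤n , shift (bound₁ refl)
  where open Desubstitution no11 {1} R
... | suc (suc r)   , refl = 2 + r , s≤s z≤n , shift (bound₂₊ refl)
  where open Desubstitution no11 {2 + r} R

No11-drop : ∀ {w} k → No11 w → No11 (drop k w)
No11-drop {w} k no11 i (e , e′) =
  no11 (k + i) (trans (sym (drop-apply k w i)) e , trans (cong w (sym (+-suc k i))) (trans (sym (drop-apply k w (suc i))) e′))

No11-𝟎◂ : ∀ {w} → No11 w → No11 (𝟎 ◂ w)
No11-𝟎◂ no11 zero    (e , _) = 𝟎≢𝟏 e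
No11-𝟎◂ no11 (suc i) e       = no11 i e

Is4⁻PowerAt-drop : ∀ {w k p} → Is4⁻PowerAt w k p → Is4⁻PowerAt (drop k w) 0 p
Is4⁻PowerAt-drop {w} {k} = Is4⁻PowerAt-transport λ n → sym (drop-apply k w n)

drop-Is4⁻PowerAt : ∀ {w k p} → Is4⁻PowerAt (drop k w) 0 p → Is4⁻PowerAt w k p
drop-Is4⁻PowerAt {w} {k} = Is4⁻PowerAt-transport (drop-apply k w)

Is4⁻PowerAt-◂ : ∀ {b w i p} → Is4⁻PowerAt (b ◂ w) (suc i) p → Is4⁻PowerAt w i p
Is4⁻PowerAt-◂ = Is4⁻PowerAt-transport λ _ → refl

0<φpos-suc : ∀ a k → 0 < φpos a (suc k)
0<φpos-suc a k = ≤-<-trans z≤n (φpos-< a k)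

-- Without 11, the letters before w i ≡ 𝟏 and before its copy w (i + p) are both 0,
-- so the power can start one letter earlier.
Is4⁻PowerAt-at-𝟎 : ∀ {w} → No11 w → w 0 ≡ 𝟎 → ∀ {i p} → Is4⁻PowerAt w i p →
                   ∃[ i′ ] w i′ ≡ 𝟎 × Is4⁻PowerAt w i′ p
Is4⁻PowerAt-at-𝟎 {w} no11 w₀ {i} R with w i in wᵢ
... | 𝟎 = i , wᵢ , R
Is4⁻PowerAt-at-𝟎 {w} no11 w₀ {zero} R | 𝟏 = ⊥-elim (𝟎≢𝟏 (trans (sym w₀) wᵢ))
Is4⁻PowerAt-at-𝟎 {w} no11 w₀ {suc i} {p} R | 𝟏 = i , wᵢ₋₁ , R′
  where
  wᵢ₋₁ : w i ≡ 𝟎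
  wᵢ₋₁ = ≢𝟏⇒≡𝟎 λ e → no11 i (e , wᵢ)
  R′ : Is4⁻PowerAt w i p
  R′ .periodic zero b = trans (cong w (+-identityʳ i)) (trans wᵢ₋₁ (sym (≢𝟏⇒≡𝟎 λ e → no11 (i + (p + 0)) (e , next≡𝟏))))
    where
    next≡𝟏 : w (suc (i + (p + 0))) ≡ 𝟏
    next≡𝟏 = trans (sym (R .periodic 0 b)) (trans (cong (λ n → w (suc n)) (+-identityʳ i)) wᵢ)
  R′ .periodic (suc j) b = trans (cong w (+-suc i j)) (trans (R .periodic j (≤-trans (n≤1+n _) b))
    (cong w (sym (trans (cong (i +_) (+-suc p j)) (+-suc i (p + j))))))

φω-No4⁻Power : ∀ {v} → No11 v → No4⁻Power v → No4⁻Power (φω v)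
φω-No4⁻Power {v} no11 nr i p R with Is4⁻PowerAt-at-𝟎 (φω-no11 v) refl R
... | i′ , φᵢ′≡𝟎 , R′ with φω-𝟎⇒φpos {v} {i′} φᵢ′≡𝟎
... | k , refl with desubstitute (No11-drop k no11) (s≤s z≤n) (Is4⁻PowerAt-transport {c′ = 0} (φω-drop k v) R′)
... | q , 0<q , Rq = no4⁻Power nr 0<q (drop-Is4⁻PowerAt {k = k} Rq)

φω-FauxBonacci′ : ∀ {v} → FauxBonacci′ v → FauxBonacci′ (φω v)
φω-FauxBonacci′ {v} (no11 , nr) = φω-no11 v , φω-No4⁻Power no11 nr

-- 11 in v at k gives 000 = (0)(0)(0)⁻ in φω v at φpos v k.
φω-No4⁻Power⇒No11 : ∀ {v} → No4⁻Power (φω v) → No11 v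
φω-No4⁻Power⇒No11 {v} nr k (e , e′) =
  nr (φpos v k) 0 (constant⇒Is4⁻PowerAt₁ (φω-φpos v k) (trans (φω-suc-φpos v k) (cong compl e)) e₂)
  where
  φpos-suc-k : φpos v (suc k) ≡ suc (φpos v k)
  φpos-suc-k = φpos-suc-≡ v k e
  e₂ : φω v (2 + φpos v k) ≡ 𝟎
  e₂ = trans (cong (λ n → φω v (suc n)) (sym φpos-suc-k)) (trans (φω-suc-φpos v (suc k)) (cong compl e′))

φω-No4⁻Power⁻¹ : ∀ {v} → No4⁻Power (φω v) → No4⁻Power v
φω-No4⁻Power⁻¹ {v} nr k s R = no4⁻Power nr (0<φpos-suc (drop k v) s)
  (Is4⁻PowerAt-transport {c = 0} {c′ = φpos v k} (λ n → sym (φω-drop k v n)) (φω-Is4⁻PowerAt₀ (Is4⁻PowerAt-drop R)))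

φω-FauxBonacci′⁻¹ : ∀ {v} → FauxBonacci′ (φω v) → FauxBonacci′ v
φω-FauxBonacci′⁻¹ (_ , nr) = φω-No4⁻Power⇒No11 nr , φω-No4⁻Power⁻¹ nr

φω-𝟎◂ : ∀ v n → φω (𝟎 ◂ v) (suc n) ≡ (𝟏 ◂ φω v) n
φω-𝟎◂ v zero    = refl
φω-𝟎◂ v (suc n) = refl

𝟏◂φω-FauxBonacci′ : ∀ {v} → FauxBonacci′ (𝟎 ◂ v) → FauxBonacci′ (𝟏 ◂ φω v)
𝟏◂φω-FauxBonacci′ {v} F = FauxBonacci′-tail (φω-FauxBonacci′ F) (φω-𝟎◂ v)

𝟏◂φω⇒FauxBonacci′ : ∀ {v} → FauxBonacci′ (𝟏 ◂ φω v) → FauxBonacci′ v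
𝟏◂φω⇒FauxBonacci′ F = φω-FauxBonacci′⁻¹ (FauxBonacci′-tail F λ _ → refl)

φω-𝟏-step : ∀ {v k n} → φpos v k ≡ n → φω v (suc n) ≡ 𝟏 → v k ≡ 𝟎 × φpos v (suc k) ≡ n + 2
φω-𝟏-step {v} {k} {n} refl e = vₖ≡𝟎 , trans (φpos-suc-≡ v k vₖ≡𝟎) (+-comm 2 n)
  where
  vₖ≡𝟎 : v k ≡ 𝟎
  vₖ≡𝟎 = compl-injective (trans (sym (φω-suc-φpos v k)) e)

-- 010101 can only be the image of 000.
φω-𝟏𝟏𝟏⇒Is4⁻PowerAt₁ : ∀ {v n} → φω v (suc n) ≡ 𝟏 → φω v (suc (n + 2)) ≡ 𝟏 → φω v (suc (n + 4)) ≡ 𝟏 →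
                      ∃[ k ] Is4⁻PowerAt v k 1
φω-𝟏𝟏𝟏⇒Is4⁻PowerAt₁ {v} {n} e₀ e₂ e₄ with φω-𝟏⇒φpos e₀
... | k , n≡ , vₖ with φω-𝟏-step {v} {k} (sym n≡) e₀
... | _ , pos₁ with φω-𝟏-step {v} {suc k} pos₁ e₂
... | vₖ₊₁ , pos₂ with φω-𝟏-step {v} {2 + k} (trans pos₂ (+-assoc n 2 2)) e₄
... | vₖ₊₂ , _ = k , constant⇒Is4⁻PowerAt₁ vₖ vₖ₊₁ vₖ₊₂

𝟏◂φω-Is4⁻PowerAt₀ : ∀ {v p} → v 0 ≡ 𝟎 → v 1 ≡ 𝟎 → Is4⁻PowerAt (𝟏 ◂ φω v) 0 (2 + p) → ∃[ k ] Is4⁻PowerAt v k 1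
𝟏◂φω-Is4⁻PowerAt₀ {v} {p} v₀ v₁ R = φω-𝟏𝟏𝟏⇒Is4⁻PowerAt₁ {v} {p} e₀ e₂ e₄
  where
  b : ∀ {j} → j ≤ 4 → 2 + j ≤ 3 * (2 + p)
  b j≤4 = ≤-trans (+-monoʳ-≤ 2 j≤4) (*-monoʳ-≤ 3 {2} {2 + p} (s≤s (s≤s z≤n)))
  e₀ : φω v (suc p) ≡ 𝟏
  e₀ = trans (cong (λ n → φω v (suc n)) (sym (+-identityʳ p))) (sym (R .periodic 0 (b z≤n)))
  e₂ : φω v (suc (p + 2)) ≡ 𝟏
  e₂ = trans (sym (R .periodic 2 (b (s≤s (s≤s z≤n))))) (trans (φω-1 v) (cong compl v₀))
  φpos₁ : φpos v 1 ≡ 2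
  φpos₁ = cong (λ b → ∣φ∣ b + 0) v₀
  e₄ : φω v (suc (p + 4)) ≡ 𝟏
  e₄ = trans (sym (R .periodic 4 (b ≤-refl)))
    (trans (cong (λ n → φω v (suc n)) (sym φpos₁)) (trans (φω-suc-φpos v 1) (cong compl v₁)))

𝟏◂φω-FauxBonacci′-𝟎𝟎 : ∀ {v} → FauxBonacci′ v → v 0 ≡ 𝟎 → v 1 ≡ 𝟎 → FauxBonacci′ (𝟏 ◂ φω v)
𝟏◂φω-FauxBonacci′-𝟎𝟎 {v} F v₀ v₁ = no11 , nr
  where
  Fφ = φω-FauxBonacci′ F
  no11 : No11 (𝟏 ◂ φω v)
  no11 zero    (_ , e) = 𝟎≢𝟏 e
  no11 (suc i) e       = proj₁ Fφ i e
  nr : No4⁻Power (𝟏 ◂ φω v)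
  nr (suc i) p       R = proj₂ Fφ i p (Is4⁻PowerAt-◂ R)
  nr zero    zero    R = 𝟎≢𝟏 (sym (R .periodic 0 (s≤s (s≤s z≤n))))
  nr zero    (suc p) R = let k , R₁ = 𝟏◂φω-Is4⁻PowerAt₀ {v} {p} v₀ v₁ R in proj₂ F k 0 R₁

-- A power XXXX⁻ at the start of 0v with |X| ≥ 2. If X ends in 1, |φ(XXXX⁻)| = 4|φ(X)| − 1,
-- and φ(XXXX⁻)0 without its first letter is a power at the start of 1φ(v). If X ends in 0
-- and XXXX⁻ is followed by 0, the same holds for φ(XXXX). Otherwise XXXX⁻ is followed
-- by 1, so it ends in 0, and periodicity puts 000 into v.
module 𝟎◂PowerAt₀ {v} (F : FauxBonacci′ (𝟏 ◂ φω v)) {r} (R : Is4⁻PowerAt (𝟎 ◂ v) 0 (2 + r)) where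
  private
    v₀ = 𝟎 ◂ v
    s = suc r
    q = suc s
    P = φpos v₀ q
    Fv : FauxBonacci′ v
    Fv = 𝟏◂φω⇒FauxBonacci′ F
    per : HasPeriodUpTo v₀ q (q + (q + s))
    per = Is4⁻PowerAt⇒HasPeriodUpTo R
    s<3q-1 : s < q + (q + s)
    s<3q-1 = <-trans (m<n+m s {q} (s≤s z≤n)) (m<n+m (q + s) {q} (s≤s z≤n))

    φω-image : ∀ {m} → HasPeriodUpTo v₀ q m → (∀ J → 2 + J ≤ 3 * P → 1 + J ≤ φpos v₀ m) → ⊥
    φω-image per′ bound = no4⁻Power (proj₂ F) (0<φpos-suc v₀ s)
      (Is4⁻PowerAt-transport {c = 1} {c′ = 0} (φω-𝟎◂ v) (φω-Is4⁻PowerAt per′ bound))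

    last-𝟏 : v₀ s ≡ 𝟏 → ⊥
    last-𝟏 e = φω-image per λ J b → ≤-pred (begin
      2 + J                            ≤⟨ b ⟩
      3 * P                            ≡⟨ 3*n≡n+[n+n] P ⟩
      P + (P + P)                      ≡⟨ cong (λ n → P + (P + n)) P≡ ⟩
      P + (P + suc (φpos v₀ s))        ≡⟨ trans (cong (P +_) (+-suc P _)) (+-suc P _) ⟩
      suc (P + (P + φpos v₀ s))        ≡⟨ cong suc (sym (φpos-periodic³ per)) ⟩
      suc (φpos v₀ (q + (q + s)))      ∎)
      where
      open ≤-Reasoning
      P≡ : P ≡ suc (φpos v₀ s)
      P≡ = φpos-suc-≡ v₀ s e

    full-power : v₀ s ≡ 𝟎 → v₀ (q + (q + (q + s))) ≡ 𝟎 → ⊥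
    full-power e e′ = φω-image per⁺ λ J b →
      subst (suc J ≤_) (sym (φpos-periodic³ per⁺)) (≤-trans (n≤1+n _) (subst (2 + J ≤_) (3*n≡n+[n+n] P) b))
      where
      at-3q-1 : v₀ (q + (q + s)) ≡ 𝟎
      at-3q-1 = trans (sym (per (q + s) (m<n+m (q + s) {q} (s≤s z≤n)))) (trans (sym (per s s<3q-1)) e)
      per⁺ : HasPeriodUpTo v₀ q (q + (q + q))
      per⁺ = subst (HasPeriodUpTo v₀ q) (sym (trans (cong (q +_) (+-suc q s)) (+-suc q _)))
                   (HasPeriodUpTo-extend per (trans at-3q-1 (sym e′)))

    forces-𝟎𝟎𝟎 : v₀ s ≡ 𝟎 → v₀ (q + (q + (q + s))) ≡ 𝟏 → ⊥
    forces-𝟎𝟎𝟎 e e′ = no4⁻Power (proj₂ Fv) (s≤s z≤n) (constant⇒Is4⁻PowerAt₁ {v} {s + r} at-2q-2 at-2q-1 at-2q)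
      where
      at-4q-2 : v₀ (q + (q + (q + r))) ≡ 𝟎
      at-4q-2 = ≢𝟏⇒≡𝟎 λ c → No11-𝟎◂ (proj₁ Fv) _ (c , trans (cong v₀ (sym 4q-1≡1+[4q-2])) e′)
        where
        4q-1≡1+[4q-2] : q + (q + (q + s)) ≡ suc (q + (q + (q + r)))
        4q-1≡1+[4q-2] = trans (cong (λ n → q + (q + n)) (+-suc q r)) (trans (cong (q +_) (+-suc q _)) (+-suc q _))
      at-2q-2 : v (s + r) ≡ 𝟎
      at-2q-2 = trans (per (q + r) (+-monoʳ-< q (<-≤-trans ≤-refl (m≤n+m s q))))
                (trans (per (q + (q + r)) (+-monoʳ-< q (+-monoʳ-< q ≤-refl))) at-4q-2)
      at-2q-1 : v (suc (s + r)) ≡ 𝟎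
      at-2q-1 = trans (cong v (sym (+-suc s r))) (trans (sym (per s s<3q-1)) e)
      at-2q : v (2 + (s + r)) ≡ 𝟎
      at-2q = trans (cong v (sym (trans (+-suc s s) (cong suc (+-suc s r)))))
                (trans (sym (per q (m<m+n q (s≤s z≤n)))) (trans (cong v₀ (sym (+-identityʳ q))) (sym (per 0 (s≤s z≤n)))))

  absurd : ⊥
  absurd with v₀ s in eₛ | v₀ (q + (q + (q + s))) in e′
  ... | 𝟏 | _ = last-𝟏 eₛ
  ... | 𝟎 | 𝟎 = full-power eₛ e′
  ... | 𝟎 | 𝟏 = forces-𝟎𝟎𝟎 eₛ e′

𝟎◂-FauxBonacci′ : ∀ {v} → FauxBonacci′ (𝟏 ◂ φω v) → ¬ (v 0 ≡ 𝟎 × v 1 ≡ 𝟎) → FauxBonacci′ (𝟎 ◂ v)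
𝟎◂-FauxBonacci′ {v} F ¬𝟎𝟎 = No11-𝟎◂ (proj₁ Fv) , nr
  where
  Fv : FauxBonacci′ v
  Fv = 𝟏◂φω⇒FauxBonacci′ F
  nr : No4⁻Power (𝟎 ◂ v)
  nr (suc i) p       R = proj₂ Fv i p (Is4⁻PowerAt-◂ R)
  nr zero    zero    R = ¬𝟎𝟎 (v₀≡𝟎 , trans (sym (R .periodic 1 ≤-refl)) v₀≡𝟎)
    where
    v₀≡𝟎 : v 0 ≡ 𝟎
    v₀≡𝟎 = sym (R .periodic 0 (s≤s (s≤s z≤n)))
  nr zero    (suc r) R = 𝟎◂PowerAt₀.absurd F R

𝟏◂φω-FauxBonacci′⁻¹ : ∀ {v} → FauxBonacci′ (𝟏 ◂ φω v) →
                      FauxBonacci′ (𝟎 ◂ v) ⊎ (FauxBonacci′ v × v 0 ≡ 𝟎 × v 1 ≡ 𝟎)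
𝟏◂φω-FauxBonacci′⁻¹ {v} F with v 0 in e₀ | v 1 in e₁
... | 𝟎 | 𝟎 = inj₂ (𝟏◂φω⇒FauxBonacci′ F , refl , refl)
... | 𝟎 | 𝟏 = inj₁ (𝟎◂-FauxBonacci′ F λ (_ , e) → 𝟎≢𝟏 (trans (sym e) e₁))
... | 𝟏 | _ = inj₁ (𝟎◂-FauxBonacci′ F λ (e , _) → 𝟎≢𝟏 (trans (sym e) e₀))

lemma4 : (v : Word) →
    ((φω v ∈U) ⇔ (v ∈U))
    × (((𝟏 ◂ φω v) ∈U) ⇔ (((𝟎 ◂ v) ∈U) ⊎ (v ∈U[ 𝟎 ∷ 𝟎 ∷ [] ])))
lemma4 v = mk⇔ (from′ ∘ φω-FauxBonacci′⁻¹ ∘ to′) (from′ ∘ φω-FauxBonacci′ ∘ to′) , mk⇔ ⇒ ⇐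
  where
  open Equivalence
  to′ : ∀ {w} → w ∈U → FauxBonacci′ w
  to′ = to (FauxBonacci⇔FauxBonacci′ _)
  from′ : ∀ {w} → FauxBonacci′ w → w ∈U
  from′ = from (FauxBonacci⇔FauxBonacci′ _)
  ⇒ : (𝟏 ◂ φω v) ∈U → (𝟎 ◂ v) ∈U ⊎ v ∈U[ 𝟎 ∷ 𝟎 ∷ [] ]
  ⇒ h with 𝟏◂φω-FauxBonacci′⁻¹ (to′ h)
  ... | inj₁ F              = inj₁ (from′ F)
  ... | inj₂ (F , e₀ , e₁)  = inj₂ (from′ F , cong₂ (λ a b → a ∷ b ∷ []) e₀ e₁)
  ⇐ : (𝟎 ◂ v) ∈U ⊎ v ∈U[ 𝟎 ∷ 𝟎 ∷ [] ] → (𝟏 ◂ φω v) ∈U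
  ⇐ (inj₁ h)          = from′ (𝟏◂φω-FauxBonacci′ (to′ h))
  ⇐ (inj₂ (h , 𝟎𝟎))   = from′ (𝟏◂φω-FauxBonacci′-𝟎𝟎 (to′ h) (∷-injectiveˡ 𝟎𝟎) (∷-injectiveˡ (∷-injectiveʳ 𝟎𝟎)))
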